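{- Let $P$ be a finite poset with $|P|\ge2$, connected Hasse diagram, and a maximum element $\hat1$, and let $r$ be a positive integer. If $\phi$ is an $r$-Gorenstein labeling of $P$, then for every $x\in P$, $$\sum_{y\le x}\phi(y)=r(\delta_{x,\hat1}-1),$$ where $\delta$ is the Kronecker delta.
   Context: For $S\subseteq P$, $cc(S)$ is the number of connected components of the subgraph of the undirected Hasse diagram of $P$ induced on $S$ ($cc(\varnothing)=0$); for an upset $A$, $\dim(A)=cc(A)+cc(P\setminus A)-1$. An $r$-Gorenstein labeling is $\phi:P\to\mathbb{Z}$ with $\sum_{z\in P}\phi(z)=0$ and $\sum_{z\in A}\phi(z)=r$ for every upset $A$ with $\dim(A)=1$. -}

module Defs where

open import Data.Nat as ℕ using (ℕ; zero; suc)
open import Data.Integer as ℤ using (ℤ; +_)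
open import Data.Bool using (Bool; true; false; _∧_; _∨_; not; if_then_else_; T)
open import Data.Fin using (Fin; toℕ; _≟_)
open import Data.List using (List; filter; length; foldr; allFin)
open import Data.Bool.ListAction using (any)
open import Data.Bool.Properties using (T?)
open import Data.Product using (_×_)
open import Relation.Nullary.Decidable using (⌊_⌋)
open import Relation.Binary.PropositionalEquality using (_≡_)

record FinPoset (n : ℕ) : Set where
  field
    _≼_     : Fin n → Fin n → Bool
    refl    : ∀ x → T (x ≼ x)
    antisym : ∀ x y → T (x ≼ y) → T (y ≼ x) → x ≡ y
    trans   : ∀ x y z → T (x ≼ y) → T (y ≼ z) → T (x ≼ z)

Subset : ℕ → Set
Subset n = Fin n → Bool

module _ {n : ℕ} (P : FinPoset n) where
  open FinPoset P

  _==_ : Fin n → Fin n → Bool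
  x == y = ⌊ x ≟ y ⌋

  _≺_ : Fin n → Fin n → Bool
  x ≺ y = (x ≼ y) ∧ not (x == y)

  covers : Fin n → Fin n → Bool
  covers x y = (x ≺ y) ∧ not (any (λ z → (x ≺ z) ∧ (z ≺ y)) (allFin n))

  hasseAdj : Fin n → Fin n → Bool
  hasseAdj x y = covers x y ∨ covers y x

  reachK : Subset n → ℕ → Fin n → Fin n → Bool
  reachK S zero    u v = S u ∧ (u == v)
  reachK S (suc k) u v =
    reachK S k u v ∨ any (λ w → reachK S k u w ∧ hasseAdj w v ∧ S v) (allFin n)

  -- connectivity in the induced subgraph (walks of length ≤ n suffice)
  connectedIn : Subset n → Fin n → Fin n → Bool
  connectedIn S = reachK S n

  -- cc(S): number of connected components of the induced subgraph on S,
  -- counted as the number of vertices of S that are the least-indexed vertex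
  -- of their component.  cc(∅) = 0.
  cc : Subset n → ℕ
  cc S = length (filter (λ v → T? (S v ∧ not (any (λ u → ⌊ toℕ u ℕ.<? toℕ v ⌋ ∧ connectedIn S u v) (allFin n)))) (allFin n))

  complement : Subset n → Subset n
  complement A x = not (A x)

  full : Subset n
  full _ = true

  IsUpset : Subset n → Set
  IsUpset A = ∀ x y → T (A x) → T (x ≼ y) → T (A y)

  dim : Subset n → ℤ
  dim A = (+ cc A) ℤ.+ (+ cc (complement A)) ℤ.- ℤ.1ℤ

  sumOver : Subset n → (Fin n → ℤ) → ℤ
  sumOver A φ = foldr (λ z acc → (if A z then φ z else ℤ.0ℤ) ℤ.+ acc) ℤ.0ℤ (allFin n)

  IsGorensteinLabeling : ℤ → (Fin n → ℤ) → Set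
  IsGorensteinLabeling r φ =
    sumOver full φ ≡ ℤ.0ℤ ×
    (∀ A → IsUpset A → dim A ≡ ℤ.1ℤ → sumOver A φ ≡ r)

  downset : Fin n → Subset n
  downset x y = y ≼ x

  HasseConnected : Set
  HasseConnected = cc full ≡ 1

{-# OPTIONS --safe #-}
module Submission where

-- For x = 1̂ the downset is all of P, whose labels sum to 0.  Otherwise
-- A = P ∖ ↓x is an upset containing 1̂, and both A and ↓x are connected in the
-- Hasse diagram: a saturated chain from any v ∈ A up to 1̂ stays in A, and one
-- from any v ∈ ↓x up to x stays in ↓x.  Hence dim A = 1, the labels on A sum
-- to r, and those on ↓x sum to −r.

open import Defs
open import Data.Nat using (ℕ; _≤_; NonZero)
open import Data.Integer using (ℤ; +_; _*_; _-_; 0ℤ; 1ℤ)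
open import Data.Fin using (Fin; _≟_)
open import Data.Bool using (T; if_then_else_)
open import Relation.Nullary.Decidable using (⌊_⌋)
open import Relation.Binary.PropositionalEquality using (_≡_)

import Data.Integer.Properties as ℤ
open import Algebra.Properties.AbelianGroup ℤ.+-0-abelianGroup using (inverseˡ-unique)
open import Algebra.Properties.CommutativeSemigroup ℤ.+-commutativeSemigroup using (interchange)
open import Data.Bool using (Bool; true; false; _∧_; not)
open import Data.Bool.ListAction using (any)
open import Data.Bool.Properties using (T-∧; T-∨; ∨-comm; not-involutive)
open import Data.Fin using (toℕ; _<_)
open import Data.Fin.Induction using () renaming (<-wellFounded to <ᶠ-wellFounded)
open import Data.Fin.Properties using (<-cmp)
open import Data.Integer using (-_; -1ℤ; _+_)
open import Data.Integer.Properties using (+-identityˡ; +-identityʳ; *-zeroʳ; *-comm; -1*i≡-i)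
open import Data.List using (List; []; _∷_; filter; length; foldr; allFin)
open import Data.List.Membership.Propositional using (_∈_; lose)
open import Data.List.Membership.Propositional.Properties using (∈-filter⁺; ∈-filter⁻; ∈-allFin; ∈-length)
open import Data.List.Properties using (length-filter; length-tabulate)
open import Data.List.Relation.Binary.Pointwise using (Pointwise-≡⇒≡)
open import Data.List.Relation.Binary.Sublist.Propositional using (⊆-refl)
open import Data.List.Relation.Binary.Sublist.Propositional.Properties using (filter⁺; length-mono-≤; to-≋)
open import Data.List.Relation.Unary.All using (_∷_)
open import Data.List.Relation.Unary.AllPairs using ([]; _∷_)
open import Data.List.Relation.Unary.Any using (here; there; satisfied)
open import Data.List.Relation.Unary.Any.Properties using (any⁺; any⁻)
open import Data.List.Relation.Unary.Unique.Propositional using (Unique)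
open import Data.List.Relation.Unary.Unique.Propositional.Properties using (allFin⁺) renaming (filter⁺ to Unique-filter⁺)
import Data.Nat as ℕ
open import Data.Nat using (suc; zero; z≤n; s≤s; _≤?_; _<?_) renaming (_<_ to _<ℕ_)
open import Data.Nat.Induction using (<-wellFounded)
open import Data.Nat.Properties using (≤-antisym; ≤-trans; ≤-reflexive; ≰⇒>; <⇒≱; +-comm)
open import Data.Product using (∃-syntax; _×_; _,_; proj₁; proj₂)
open import Data.Sum using (_⊎_; inj₁; inj₂)
open import Function using (_∘_; const; Equivalence)
open import Induction.WellFounded using (Acc; acc)
open import Relation.Binary using (Sym; tri<; tri≈; tri>)
open import Relation.Binary.Construct.Closure.ReflexiveTransitive using (Star; ε; _◅_; _◅◅_; reverse)
open import Relation.Binary.PropositionalEquality using (refl; sym; trans; cong; cong₂; subst; _≢_; module ≡-Reasoning)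
open import Relation.Nullary using (¬_; yes; no; contradiction)
open import Relation.Nullary.Decidable using (T?; toWitness; fromWitness)
open import Relation.Unary using (Pred; Decidable)

open Equivalence using (to; from)

T-not⁺ : ∀ {b} → ¬ T b → T (not b)
T-not⁺ {true}  ¬b = ¬b _
T-not⁺ {false} _  = _

T-not⁻ : ∀ {b} → T (not b) → ¬ T b
T-not⁻ {true} ()

module _ {A : Set} {p q} {P : Pred A p} {Q : Pred A q} (P? : Decidable P) (Q? : Decidable Q)
         (P⊆Q : ∀ {x} → P x → Q x) where

  length-filter-≤⇒⊇ : ∀ {xs} → length (filter Q? xs) ≤ length (filter P? xs) →
                      ∀ {x} → x ∈ xs → Q x → P x
  length-filter-≤⇒⊇ {xs} q≤p x∈xs qx =
    proj₂ (∈-filter⁻ P? {xs = xs} (subst (_ ∈_) (sym (Pointwise-≡⇒≡ filters≋)) (∈-filter⁺ Q? x∈xs qx)))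
    where
      filters⊆ = filter⁺ P? Q? (λ { refl → P⊆Q }) (⊆-refl {x = xs})
      filters≋ = to-≋ (≤-antisym (length-mono-≤ filters⊆) q≤p) filters⊆

  length-filter-< : ∀ {xs x} → x ∈ xs → Q x → ¬ P x → length (filter P? xs) <ℕ length (filter Q? xs)
  length-filter-< x∈xs qx ¬px = ≰⇒> (λ q≤p → ¬px (length-filter-≤⇒⊇ q≤p x∈xs qx))

Unique-constant⇒length≤1 : ∀ {A : Set} {xs : List A} → Unique xs →
                           (∀ {a b} → a ∈ xs → b ∈ xs → a ≡ b) → length xs ≤ 1
Unique-constant⇒length≤1 [] _ = z≤n
Unique-constant⇒length≤1 (_ ∷ []) _ = s≤s z≤n
Unique-constant⇒length≤1 ((a≢b ∷ _) ∷ _) constant = contradiction (constant (here refl) (there (here refl))) a≢b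

-- sumOver P A φ unfolds to restrictedSum A φ (allFin n).
restrictedSum : ∀ {A : Set} → (A → Bool) → (A → ℤ) → List A → ℤ
restrictedSum S φ = foldr (λ z acc → (if S z then φ z else 0ℤ) + acc) 0ℤ

restrictedSum-complement : ∀ {A : Set} (S : A → Bool) (φ : A → ℤ) xs →
  restrictedSum S φ xs + restrictedSum (not ∘ S) φ xs ≡ restrictedSum (const true) φ xs
restrictedSum-complement S φ [] = refl
restrictedSum-complement S φ (x ∷ xs) = begin
  (on S + restrictedSum S φ xs) + (on (not ∘ S) + restrictedSum (not ∘ S) φ xs)
    ≡⟨ interchange (on S) _ (on (not ∘ S)) _ ⟩
  (on S + on (not ∘ S)) + (restrictedSum S φ xs + restrictedSum (not ∘ S) φ xs)
    ≡⟨ cong₂ _+_ (split (S x)) (restrictedSum-complement S φ xs) ⟩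
  φ x + restrictedSum (const true) φ xs
    ∎
  where
    open ≡-Reasoning
    on : (_ → Bool) → ℤ
    on S′ = if S′ x then φ x else 0ℤ
    split : ∀ b → (if b then φ x else 0ℤ) + (if not b then φ x else 0ℤ) ≡ φ x
    split true  = +-identityʳ (φ x)
    split false = +-identityˡ (φ x)

restrictedSum-universal : ∀ {A : Set} (S : A → Bool) (φ : A → ℤ) → (∀ x → T (S x)) →
  ∀ xs → restrictedSum S φ xs ≡ restrictedSum (const true) φ xs
restrictedSum-universal S φ all-in [] = refl
restrictedSum-universal S φ all-in (x ∷ xs) with S x | all-in x
... | true | _ = cong (λ s → φ x + s) (restrictedSum-universal S φ all-in xs)

module _ {n : ℕ} (P : FinPoset n) where
  open FinPoset P renaming (refl to ≼-refl; trans to ≼-trans; antisym to ≼-antisym)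

  Step : Subset n → Fin n → Fin n → Set
  Step S u v = T (S u) × T (hasseAdj P u v) × T (S v)

  Step-sym : ∀ {S} → Sym (Step S) (Step S)
  Step-sym {S} {u} {v} (su , adj , sv) = sv , subst T (∨-comm (covers P u v) (covers P v u)) adj , su

  Walk : Subset n → Fin n → Fin n → Set
  Walk S = Star (Step S)

  module _ (S : Subset n) where

    -- A record, so that k, u and v can be inferred (reachK is not injective).
    record Reaches (k : ℕ) (u v : Fin n) : Set where
      constructor reaches
      field reached : T (reachK P S k u v)
    open Reaches

    Reaches-zero⁻ : ∀ {u v} → Reaches 0 u v → T (S u) × u ≡ v
    Reaches-zero⁻ {u} (reaches r) with T-∧ {S u} .to r
    ... | su , u≡v = su , toWitness u≡v

    Reaches-refl : ∀ {u} → T (S u) → Reaches 0 u u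
    Reaches-refl su = reaches (T-∧ .from (su , fromWitness refl))

    Reaches-suc⁻ : ∀ {k u v} → Reaches (suc k) u v →
                   Reaches k u v ⊎ ∃[ w ] Reaches k u w × T (hasseAdj P w v) × T (S v)
    Reaches-suc⁻ {k} {u} {v} (reaches r) with T-∨ {reachK P S k u v} .to r
    ... | inj₁ r′ = inj₁ (reaches r′)
    ... | inj₂ r′ with satisfied (any⁻ _ (allFin n) r′)
    ...   | w , r″ with T-∧ {reachK P S k u w} .to r″
    ...     | uw , adj∧sv = inj₂ (w , reaches uw , T-∧ {hasseAdj P w v} .to adj∧sv)

    Reaches-suc⁺ : ∀ {k u v} → Reaches k u v → Reaches (suc k) u v
    Reaches-suc⁺ (reaches r) = reaches (T-∨ .from (inj₁ r))

    Reaches-snoc : ∀ {k u w v} → Reaches k u w → T (hasseAdj P w v) → T (S v) → Reaches (suc k) u v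
    Reaches-snoc {w = w} (reaches uw) adj sv =
      reaches (T-∨ .from (inj₂ (any⁺ _ (lose (∈-allFin w) (T-∧ .from (uw , T-∧ .from (adj , sv)))))))

    Reaches-cons : ∀ {k u w v} → T (S u) → T (hasseAdj P u w) → Reaches k w v → Reaches (suc k) u v
    Reaches-cons {zero} su adj r with Reaches-zero⁻ r
    ... | sv , refl = Reaches-snoc (Reaches-refl su) adj sv
    Reaches-cons {suc k} su adj r with Reaches-suc⁻ r
    ... | inj₁ r′ = Reaches-suc⁺ (Reaches-cons su adj r′)
    ... | inj₂ (_ , r′ , adj′ , sv) = Reaches-snoc (Reaches-cons su adj r′) adj′ sv

    Reaches-source : ∀ {k u v} → Reaches k u v → T (S u)
    Reaches-source {zero} r = proj₁ (Reaches-zero⁻ r)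
    Reaches-source {suc k} r with Reaches-suc⁻ r
    ... | inj₁ r′ = Reaches-source r′
    ... | inj₂ (_ , r′ , _) = Reaches-source r′

    -- The sets reachable from u in at most k steps grow strictly until they
    -- stabilise, and have at most n elements, so they are stable from k = n on.
    module Saturation (u : Fin n) where

      Stable : ℕ → Set
      Stable k = ∀ {v} → Reaches (suc k) u v → Reaches k u v

      stable-suc : ∀ {k} → Stable k → Stable (suc k)
      stable-suc stable r with Reaches-suc⁻ r
      ... | inj₁ r′ = r′
      ... | inj₂ (_ , r′ , adj , sv) = Reaches-snoc (stable r′) adj sv

      stable-+ : ∀ {k} → Stable k → ∀ j → Stable (j ℕ.+ k)
      stable-+ stable zero = stable
      stable-+ stable (suc j) = stable-suc (stable-+ stable j)

      stable-absorbs : ∀ {k v} → Stable k → ∀ j → Reaches (j ℕ.+ k) u v → Reaches k u v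
      stable-absorbs stable zero r = r
      stable-absorbs stable (suc j) r = stable-absorbs stable j (stable-+ stable j r)

      Reaches-weaken : ∀ {k v} j → Reaches k u v → Reaches (j ℕ.+ k) u v
      Reaches-weaken zero r = r
      Reaches-weaken (suc j) r = Reaches-suc⁺ (Reaches-weaken j r)

      reachCount : ℕ → ℕ
      reachCount k = length (filter (T? ∘ reachK P S k u) (allFin n))

      grows-or-stable : T (S u) → ∀ k → suc k ≤ reachCount k ⊎ Stable k
      grows-or-stable su zero =
        inj₁ (∈-length (∈-filter⁺ (T? ∘ reachK P S 0 u) (∈-allFin u) (reached (Reaches-refl su))))
      grows-or-stable su (suc k) with grows-or-stable su k
      ... | inj₂ stable = inj₂ (stable-suc stable)
      ... | inj₁ grows with reachCount (suc k) ≤? reachCount k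
      ...   | yes no-growth = inj₂ (stable-suc (λ r → reaches (length-filter-≤⇒⊇
                (T? ∘ reachK P S k u) (T? ∘ reachK P S (suc k) u) (reached ∘ Reaches-suc⁺ {k} ∘ reaches)
                no-growth (∈-allFin _) (reached r))))
      ...   | no growth = inj₁ (≤-trans (s≤s grows) (≰⇒> growth))

      stable-at-n : T (S u) → Stable n
      stable-at-n su with grows-or-stable su n
      ... | inj₂ stable = stable
      ... | inj₁ grows =
        contradiction (≤-trans (length-filter _ (allFin n)) (≤-reflexive (length-tabulate _))) (<⇒≱ grows)

    Reaches⇒connectedIn : ∀ {k u v} → Reaches k u v → T (connectedIn P S u v)
    Reaches⇒connectedIn {k} {u} {v} r =
      reached (stable-absorbs (stable-at-n (Reaches-source r)) k
        (subst (λ m → Reaches m u v) (+-comm n k) (Reaches-weaken n r)))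
      where open Saturation u

    walk⇒connectedIn : ∀ {u v} → T (S u) → Walk S u v → T (connectedIn P S u v)
    walk⇒connectedIn su walk = Reaches⇒connectedIn (proj₂ (reach su walk))
      where
        reach : ∀ {u v} → T (S u) → Walk S u v → ∃[ k ] Reaches k u v
        reach su ε = 0 , Reaches-refl su
        reach su ((_ , adj , sw) ◅ walk) with reach sw walk
        ... | k , r = suc k , Reaches-cons su adj r

    -- isLeader is the predicate filtered in the definition of cc.
    connectedBefore : Fin n → Fin n → Bool
    connectedBefore v u = ⌊ toℕ u <? toℕ v ⌋ ∧ connectedIn P S u v

    isLeader : Fin n → Bool
    isLeader v = S v ∧ not (any (connectedBefore v) (allFin n))

    leader-exists : ∀ {v} → Acc _<_ v → T (S v) → ∃[ w ] T (isLeader w)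
    leader-exists {v} (acc rec) sv with T? (any (connectedBefore v) (allFin n))
    ... | no none = v , T-∧ .from (sv , T-not⁺ none)
    ... | yes some with satisfied (any⁻ _ (allFin n) some)
    ...   | u , before with T-∧ {⌊ toℕ u <? toℕ v ⌋} .to before
    ...     | u<v , uv = leader-exists (rec (toWitness u<v)) (Reaches-source {n} (reaches uv))

    Connected : Set
    Connected = ∀ {v w} → T (S v) → T (S w) → T (connectedIn P S v w)

    leader-not-after : Connected → ∀ {v w} → v < w → T (isLeader v) → ¬ T (isLeader w)
    leader-not-after connected {v} {w} v<w lv lw = T-not⁻ (proj₂ (T-∧ {S w} .to lw)) earlier
      where
        earlier : T (any (connectedBefore w) (allFin n))
        earlier = any⁺ _ (lose (∈-allFin v)
          (T-∧ .from (fromWitness v<w , connected (proj₁ (T-∧ {S v} .to lv)) (proj₁ (T-∧ {S w} .to lw)))))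

    leader-unique : Connected → ∀ {v w} → T (isLeader v) → T (isLeader w) → v ≡ w
    leader-unique connected {v} {w} lv lw with <-cmp v w
    ... | tri< v<w _ _ = contradiction lw (leader-not-after connected v<w lv)
    ... | tri≈ _ v≡w _ = v≡w
    ... | tri> _ _ w<v = contradiction lv (leader-not-after connected w<v lw)

    cc≡1 : ∀ {m} → T (S m) → (∀ {v} → T (S v) → Walk S v m) → cc P S ≡ 1
    cc≡1 {m} sm toHub = ≤-antisym at-most-one at-least-one
      where
        connected : Connected
        connected sv sw = walk⇒connectedIn sv (toHub sv ◅◅ reverse Step-sym (toHub sw))

        leaders : List (Fin n)
        leaders = filter (T? ∘ isLeader) (allFin n)

        at-most-one : length leaders ≤ 1
        at-most-one = Unique-constant⇒length≤1 (Unique-filter⁺ (T? ∘ isLeader) (allFin⁺ n))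
          (λ a∈ b∈ → leader-unique connected (proj₂ (∈-filter⁻ (T? ∘ isLeader) {xs = allFin n} a∈))
                                             (proj₂ (∈-filter⁻ (T? ∘ isLeader) {xs = allFin n} b∈)))

        at-least-one : 1 ≤ length leaders
        at-least-one with leader-exists (<ᶠ-wellFounded m) sm
        ... | w , lw = ∈-length (∈-filter⁺ (T? ∘ isLeader) (∈-allFin w) lw)

  ≺⁻ : ∀ {x y} → T (_≺_ P x y) → T (x ≼ y) × x ≢ y
  ≺⁻ {x} {y} x≺y with T-∧ {x ≼ y} .to x≺y
  ... | x≼y , x≠y = x≼y , T-not⁻ x≠y ∘ fromWitness

  ≺⁺ : ∀ {x y} → T (x ≼ y) → x ≢ y → T (_≺_ P x y)
  ≺⁺ x≼y x≢y = T-∧ .from (x≼y , T-not⁺ (x≢y ∘ toWitness))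

  intervalSize : Fin n → Fin n → ℕ
  intervalSize y x = length (filter (λ w → T? ((y ≼ w) ∧ (w ≼ x))) (allFin n))

  intervalSize-shrinkʳ : ∀ {y z x} → T (y ≼ z) → T (z ≼ x) → z ≢ x → intervalSize y z <ℕ intervalSize y x
  intervalSize-shrinkʳ {y} {z} {x} y≼z z≼x z≢x =
    length-filter-< (λ w → T? ((y ≼ w) ∧ (w ≼ z))) (λ w → T? ((y ≼ w) ∧ (w ≼ x)))
      (λ {w} w∈ → let (y≼w , w≼z) = T-∧ {y ≼ w} .to w∈ in T-∧ .from (y≼w , ≼-trans w z x w≼z z≼x))
      (∈-allFin x) (T-∧ .from (≼-trans y z x y≼z z≼x , ≼-refl x))
      (λ x∈ → z≢x (≼-antisym z x z≼x (proj₂ (T-∧ {y ≼ x} .to x∈))))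

  intervalSize-shrinkˡ : ∀ {y z x} → T (y ≼ z) → T (z ≼ x) → y ≢ z → intervalSize z x <ℕ intervalSize y x
  intervalSize-shrinkˡ {y} {z} {x} y≼z z≼x y≢z =
    length-filter-< (λ w → T? ((z ≼ w) ∧ (w ≼ x))) (λ w → T? ((y ≼ w) ∧ (w ≼ x)))
      (λ {w} w∈ → let (z≼w , w≼x) = T-∧ {z ≼ w} .to w∈ in T-∧ .from (≼-trans y z w y≼z z≼w , w≼x))
      (∈-allFin y) (T-∧ .from (≼-refl y , ≼-trans y z x y≼z z≼x))
      (λ y∈ → y≢z (≼-antisym y z y≼z (proj₁ (T-∧ {z ≼ y} .to y∈))))

  -- Refine y ≼ x into a saturated chain: split at any element strictly between,
  -- which makes both intervals smaller.
  interval-walk : ∀ S {y x} → T (y ≼ x) → (∀ {w} → T (y ≼ w) → T (w ≼ x) → T (S w)) → Walk S y x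
  interval-walk S y≼x ⊆S = walk (<-wellFounded _) y≼x ⊆S
    where
      walk : ∀ {y x} → Acc _<ℕ_ (intervalSize y x) → T (y ≼ x) →
             (∀ {w} → T (y ≼ w) → T (w ≼ x) → T (S w)) → Walk S y x
      walk {y} {x} (acc rec) y≼x ⊆S with y ≟ x
      ... | yes refl = ε
      ... | no y≢x with T? (any (λ z → _≺_ P y z ∧ _≺_ P z x) (allFin n))
      ...   | no nothing-between =
        (⊆S (≼-refl y) y≼x , T-∨ .from (inj₁ y⋖x) , ⊆S y≼x (≼-refl x)) ◅ ε
        where
          y⋖x : T (covers P y x)
          y⋖x = T-∧ .from (≺⁺ y≼x y≢x , T-not⁺ nothing-between)
      ...   | yes something-between with satisfied (any⁻ _ (allFin n) something-between)
      ...     | z , y≺z≺x with T-∧ {_≺_ P y z} .to y≺z≺x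
      ...       | y≺z , z≺x with ≺⁻ y≺z | ≺⁻ z≺x
      ...         | y≼z , y≢z | z≼x , z≢x =
        walk (rec (intervalSize-shrinkʳ y≼z z≼x z≢x)) y≼z (λ y≼w w≼z → ⊆S y≼w (≼-trans _ z x w≼z z≼x))
        ◅◅ walk (rec (intervalSize-shrinkˡ y≼z z≼x y≢z)) z≼x (λ z≼w w≼x → ⊆S (≼-trans y z _ y≼z z≼w) w≼x)

  co-downset-isUpset : ∀ x → IsUpset P (complement P (downset P x))
  co-downset-isUpset x a b a∉↓x a≼b = T-not⁺ (λ b≼x → T-not⁻ a∉↓x (≼-trans a b x a≼b b≼x))

  dim-co-downset : ∀ {top} → (∀ x → T (x ≼ top)) → ∀ {x} → x ≢ top → dim P (complement P (downset P x)) ≡ 1ℤ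
  dim-co-downset {top} ≼top {x} x≢top =
    cong₂ (λ a b → + a + + b - 1ℤ) (cc≡1 A top∈A toTop) (cc≡1 (complement P A) x∈↓x toX)
    where
      A : Subset n
      A = complement P (downset P x)

      top∈A : T (A top)
      top∈A = T-not⁺ (λ top≼x → x≢top (≼-antisym x top (≼top x) top≼x))

      toTop : ∀ {v} → T (A v) → Walk A v top
      toTop {v} v∈A = interval-walk A (≼top v) (λ {w} v≼w _ → co-downset-isUpset x v w v∈A v≼w)

      ↓x⁺ : ∀ {v} → T (v ≼ x) → T (complement P A v)
      ↓x⁺ {v} = subst T (sym (not-involutive (v ≼ x)))

      x∈↓x : T (complement P A x)
      x∈↓x = ↓x⁺ (≼-refl x)

      toX : ∀ {v} → T (complement P A v) → Walk (complement P A) v x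
      toX {v} v∈↓x = interval-walk (complement P A) (subst T (not-involutive (v ≼ x)) v∈↓x) (λ _ → ↓x⁺)

lemma5p1 : (n : ℕ) → 2 ≤ n → (P : FinPoset n) → HasseConnected P →
    (top : Fin n) → (∀ x → T (FinPoset._≼_ P x top)) →
    (r : ℕ) → NonZero r → (φ : Fin n → ℤ) → IsGorensteinLabeling P (+ r) φ →
    ∀ x → sumOver P (downset P x) φ ≡ (+ r) * ((if ⌊ x ≟ top ⌋ then 1ℤ else 0ℤ) - 1ℤ)
lemma5p1 n _ P _ top ≼top r _ φ (sum≡0 , gorenstein) x with x ≟ top
... | yes refl = begin
  sumOver P (downset P x) φ  ≡⟨ restrictedSum-universal (downset P x) φ ≼top (allFin n) ⟩
  sumOver P (full P) φ       ≡⟨ sum≡0 ⟩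
  0ℤ                         ≡⟨ *-zeroʳ (+ r) ⟨
  + r * 0ℤ                   ∎
  where open ≡-Reasoning
... | no x≢top = begin
  sumOver P (downset P x) φ  ≡⟨ inverseˡ-unique _ _ (trans (restrictedSum-complement (downset P x) φ (allFin n)) sum≡0) ⟩
  - sumOver P A φ            ≡⟨ cong -_ (gorenstein A (co-downset-isUpset P x) (dim-co-downset P ≼top x≢top)) ⟩
  - + r                      ≡⟨ -1*i≡-i (+ r) ⟨
  -1ℤ * + r                  ≡⟨ *-comm -1ℤ (+ r) ⟩
  + r * -1ℤ                  ∎
  where
    open ≡-Reasoning
    A : Subset n
    A = complement P (downset P x)
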